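{- The maximum number of removable edges of a Skolem circle of order $m$ is $O(\log m)$; that is, there is a constant $K$ such that for every $m\ge 2$, every Skolem circle of order $m$ has at most $K\log m$ removable edges.
   Context: Let $C_{2m}$ be the cycle graph with vertices $v_1,\dots,v_{2m}$ in cyclic order. A Skolem circle of order $m$ is a labelling of the vertices of $C_{2m}$ by labels from $\{1,\dots,m\}$ such that each label is used exactly twice and any two vertices with the same label $s$ are at distance exactly $s$ in $C_{2m}$. An edge $e$ of $C_{2m}$ is removable if in the path $C_{2m}-e$ any two vertices with the same label $s$ are still at distance exactly $s$. -}

module Defs where

open import Data.Nat using (ℕ; suc; _+_; _*_; _∸_; _≤_; _<ᵇ_; _⊓_; ∣_-_∣)
open import Data.Fin using (Fin; toℕ)
open import Data.Bool using (if_then_else_)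
open import Data.Product using (Σ; ∃; _×_; _,_)
open import Data.Sum using (_⊎_)
open import Relation.Nullary using (¬_)
open import Relation.Binary.PropositionalEquality using (_≡_; _≢_)

-- Vertices of the cycle C_n are Fin n (v_1,…,v_n ↦ 0,…,n-1); v i adjacent to v (i+1 mod n).
-- Distance in the cycle C_n between two vertices.
cycleDist : (n : ℕ) → Fin n → Fin n → ℕ
cycleDist n a b = ∣ toℕ a - toℕ b ∣ ⊓ (n ∸ ∣ toℕ a - toℕ b ∣)

-- Edges of C_n are indexed by k : Fin n, edge k = {v k, v (k+1 mod n)}.
-- In the path C_n - e_k, the vertices in order are v(k+1), v(k+2), …, v(k) (indices mod n);
-- pathPos n k v is the position of v along that path.
pathPos : (n : ℕ) → Fin n → Fin n → ℕ
pathPos n k v =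
  if toℕ k <ᵇ toℕ v then toℕ v ∸ suc (toℕ k) else (toℕ v + n) ∸ suc (toℕ k)

pathDist : (n : ℕ) → Fin n → Fin n → Fin n → ℕ
pathDist n k a b = ∣ pathPos n k a - pathPos n k b ∣

Labelling : ℕ → Set
Labelling m = Fin (2 * m) → ℕ

record IsSkolemCircle (m : ℕ) (f : Labelling m) : Set where
  field
    labelRange : ∀ v → 1 ≤ f v × f v ≤ m
    usedTwice  : ∀ s → 1 ≤ s → s ≤ m →
                 Σ (Fin (2 * m)) λ a → Σ (Fin (2 * m)) λ b →
                   a ≢ b × f a ≡ s × f b ≡ s ×
                   (∀ c → f c ≡ s → c ≡ a ⊎ c ≡ b)
    distance   : ∀ a b → a ≢ b → f a ≡ f b → cycleDist (2 * m) a b ≡ f a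

Removable : (m : ℕ) → Labelling m → Fin (2 * m) → Set
Removable m f k = ∀ a b → a ≢ b → f a ≡ f b → pathDist (2 * m) k a b ≡ f a

-- Cut the cycle at two removable edges x < y. A vertex v between them has a
-- partner w with the same label s. If w is also between the cuts then
-- s < y − x; otherwise the two paths left by the cuts measure the two
-- complementary arcs from v to w, both of length s, so s = m. Hence, for the
-- removable edges in increasing order, the vertices on gaps shorter than t all
-- carry labels below t or equal to m, so these gaps have total length at most
-- 2t + 2. Comparing the thresholds t and 2t shows that at most 6 gaps have
-- length in [t, 2t), and all gaps are shorter than 2m < 2^(⌊log₂ m⌋ + 2).

module Submission where

open import Defs
open import Data.Nat
open import Data.Nat.Properties
open import Data.Fin using (Fin; toℕ; fromℕ<)
open import Data.Fin.Properties using (toℕ<n; nonZeroIndex; toℕ-fromℕ<; toℕ-injective)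
open import Data.Nat.Logarithm using (⌊log₂_⌋; ⌊log₂⌋-mono-≤; ⌊log₂[2^n]⌋≡n)
open import Data.Bool using (true; false; if_then_else_)
open import Data.Product using (Σ; _×_; _,_; proj₁; proj₂; uncurry)
open import Function using (_∘_)
open import Data.Sum as Sum using (_⊎_; inj₁; inj₂)
open import Data.Empty using (⊥; ⊥-elim)
open import Data.List using (List; []; _∷_; _++_; length; map; filter; applyUpTo)
open import Data.List.Properties using (length-++; length-map; length-applyUpTo; filter-none; filter-all)
open import Data.List.Sort ≤-decTotalOrder using (sort; sort-↭; sort-↗)
open import Data.List.Relation.Unary.Linked.Properties using (Linked⇒AllPairs)
open import Data.Nat.ListAction using (sum)
open import Data.List.Relation.Unary.All as All using (All; []; _∷_)
import Data.List.Relation.Unary.All.Properties as AllP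
open import Data.List.Relation.Unary.AllPairs as AllPairs using (AllPairs; []; _∷_)
import Data.List.Relation.Unary.AllPairs.Properties as APP
open import Data.List.Relation.Unary.Unique.Propositional using (Unique)
import Data.List.Relation.Unary.Unique.Propositional.Properties as Unique
open import Data.List.Relation.Binary.Permutation.Propositional
  using (_↭_; prep; swap; ↭-sym) renaming (refl to ↭-refl; trans to ↭-trans)
open import Data.List.Relation.Binary.Permutation.Propositional.Properties using (All-resp-↭; ↭-length)
import Relation.Unary as U
open import Relation.Unary.Properties using (∁?)
open import Relation.Nullary using (¬_; yes; no; contradiction)
open import Relation.Nullary.Decidable using (Dec; _×-dec_)
open import Relation.Nullary.Reflects using (ofʸ; ofⁿ)
open import Relation.Binary.PropositionalEquality
open import Data.Nat.Tactic.RingSolver using (solve-∀)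

m∸[n+o]+o≡m∸n : ∀ {m} n o → n + o ≤ m → m ∸ (n + o) + o ≡ m ∸ n
m∸[n+o]+o≡m∸n {m} n o n+o≤m = begin
  m ∸ (n + o) + o   ≡⟨ cong (_+ o) (∸-+-assoc m n o) ⟨
  m ∸ n ∸ o + o     ≡⟨ m∸n+n≡m (m+n≤o⇒m≤o∸n o (subst (_≤ m) (+-comm n o) n+o≤m)) ⟩
  m ∸ n             ∎
  where open ≡-Reasoning

∣m-n∣≡o⇒o+m≡n : ∀ {m n o} → m ≤ n → ∣ m - n ∣ ≡ o → o + m ≡ n
∣m-n∣≡o⇒o+m≡n m≤n refl rewrite m≤n⇒∣m-n∣≡n∸m m≤n = m∸n+n≡m m≤n

∣m-n∣<o : ∀ {m n o} → m < o → n < o → ∣ m - n ∣ < o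
∣m-n∣<o {m} {n} m<o n<o = ≤-<-trans (∣m-n∣≤m⊔n m n) (⊔-lub m<o n<o)

-- p, q and p′, q′ are the positions of two vertices along two paths that
-- see complementary arcs between them.
equal-complementary-distances : ∀ {n g p q p′ q′ s} → p < q → q < p + n →
  p′ + g ≡ p + n → q′ + g ≡ q → ∣ p - q ∣ ≡ s → ∣ p′ - q′ ∣ ≡ s → s + s ≡ n
equal-complementary-distances {n} {g} {p} {q} {p′} {q′} {s} p<q q<p+n p′+g≡p+n q′+g≡q d d′ =
  +-cancelʳ-≡ p (s + s) n (begin
    s + s + p         ≡⟨ +-assoc s s p ⟩
    s + (s + p)       ≡⟨ cong (s +_) s+p≡q ⟩
    s + q             ≡⟨ cong (s +_) q′+g≡q ⟨
    s + (q′ + g)      ≡⟨ +-assoc s q′ g ⟨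
    s + q′ + g        ≡⟨ cong (_+ g) s+q′≡p′ ⟩
    p′ + g            ≡⟨ p′+g≡p+n ⟩
    p + n             ≡⟨ +-comm p n ⟩
    n + p             ∎)
  where
  open ≡-Reasoning
  s+p≡q : s + p ≡ q
  s+p≡q = ∣m-n∣≡o⇒o+m≡n (<⇒≤ p<q) d
  q′<p′ : q′ < p′
  q′<p′ = +-cancelʳ-< g q′ p′ (subst₂ _<_ (sym q′+g≡q) (sym p′+g≡p+n) q<p+n)
  s+q′≡p′ : s + q′ ≡ p′
  s+q′≡p′ = ∣m-n∣≡o⇒o+m≡n (<⇒≤ q′<p′) (trans (∣-∣-comm q′ p′) d′)

module _ {n : ℕ} (k v : Fin n) where

  pathPos-after : toℕ k < toℕ v → pathPos n k v ≡ toℕ v ∸ suc (toℕ k)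
  pathPos-after k<v with toℕ k <ᵇ toℕ v | <ᵇ-reflects-< (toℕ k) (toℕ v)
  ... | true  | _       = refl
  ... | false | ofⁿ k≮v = contradiction k<v k≮v

  pathPos-upTo : toℕ v ≤ toℕ k → pathPos n k v ≡ toℕ v + n ∸ suc (toℕ k)
  pathPos-upTo v≤k with toℕ k <ᵇ toℕ v | <ᵇ-reflects-< (toℕ k) (toℕ v)
  ... | true  | ofʸ k<v = contradiction v≤k (<⇒≱ k<v)
  ... | false | _       = refl

  pathPos<n : pathPos n k v < n
  pathPos<n with toℕ k <? toℕ v
  ... | yes k<v = subst (_< n) (sym (pathPos-after k<v)) (≤-<-trans (m∸n≤m (toℕ v) (suc (toℕ k))) (toℕ<n v))
  ... | no  k≮v = subst (_< n) (sym (pathPos-upTo (≮⇒≥ k≮v)))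
                    (m<n+o⇒m∸n<o _ (suc (toℕ k)) {{nonZeroIndex v}} (+-monoˡ-< n (s≤s (≮⇒≥ k≮v))))

-- Removing edges x and y splits the cycle into two paths; these are the
-- vertices of the one not passing through vertex 0.
InArc : ∀ {n} → Fin n → Fin n → Fin n → Set
InArc x y u = toℕ x < toℕ u × toℕ u ≤ toℕ y

inArc? : ∀ {n} (x y u : Fin n) → Dec (InArc x y u)
inArc? x y u = (toℕ x <? toℕ u) ×-dec (toℕ u ≤? toℕ y)

module _ {n : ℕ} (x y : Fin n) {g : ℕ} (y≡x+g : toℕ y ≡ toℕ x + g) where

  private
    ∸-shift : ∀ c → suc (toℕ y) ≤ c → c ∸ suc (toℕ y) + g ≡ c ∸ suc (toℕ x)
    ∸-shift c y<c = trans (cong (λ z → c ∸ suc z + g) y≡x+g)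
                          (m∸[n+o]+o≡m∸n (suc (toℕ x)) g (subst (λ z → suc z ≤ c) y≡x+g y<c))

    y<u+n : (u : Fin n) → suc (toℕ y) ≤ toℕ u + n
    y<u+n u = ≤-trans (toℕ<n y) (m≤n+m n (toℕ u))

  pathPos-inArc-< : ∀ {u} → InArc x y u → pathPos n x u < g
  pathPos-inArc-< {u} (x<u , u≤y) = subst (_< g) (sym (pathPos-after x u x<u))
    (subst (toℕ u ∸ suc (toℕ x) <_) (m+n∸m≡n (suc (toℕ x)) g)
      (∸-monoˡ-< (s≤s (subst (toℕ u ≤_) y≡x+g u≤y)) x<u))

  pathPos-inArc-shift : ∀ {u} → InArc x y u → pathPos n y u + g ≡ pathPos n x u + n
  pathPos-inArc-shift {u} (x<u , u≤y) = begin
    pathPos n y u + g              ≡⟨ cong (_+ g) (pathPos-upTo y u u≤y) ⟩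
    toℕ u + n ∸ suc (toℕ y) + g    ≡⟨ ∸-shift (toℕ u + n) (y<u+n u) ⟩
    toℕ u + n ∸ suc (toℕ x)        ≡⟨ +-∸-comm n x<u ⟩
    toℕ u ∸ suc (toℕ x) + n        ≡⟨ cong (_+ n) (pathPos-after x u x<u) ⟨
    pathPos n x u + n              ∎
    where open ≡-Reasoning

  pathPos-outArc-shift : ∀ {u} → ¬ InArc x y u → pathPos n y u + g ≡ pathPos n x u
  pathPos-outArc-shift {u} u∉ with toℕ x <? toℕ u
  ... | no x≮u = begin
    pathPos n y u + g              ≡⟨ cong (_+ g) (pathPos-upTo y u u≤y) ⟩
    toℕ u + n ∸ suc (toℕ y) + g    ≡⟨ ∸-shift (toℕ u + n) (y<u+n u) ⟩
    toℕ u + n ∸ suc (toℕ x)        ≡⟨ pathPos-upTo x u (≮⇒≥ x≮u) ⟨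
    pathPos n x u                  ∎
    where
    open ≡-Reasoning
    u≤y : toℕ u ≤ toℕ y
    u≤y = ≤-trans (≮⇒≥ x≮u) (subst (toℕ x ≤_) (sym y≡x+g) (m≤m+n (toℕ x) g))
  ... | yes x<u = begin
    pathPos n y u + g              ≡⟨ cong (_+ g) (pathPos-after y u y<u) ⟩
    toℕ u ∸ suc (toℕ y) + g        ≡⟨ ∸-shift (toℕ u) y<u ⟩
    toℕ u ∸ suc (toℕ x)            ≡⟨ pathPos-after x u x<u ⟨
    pathPos n x u                  ∎
    where
    open ≡-Reasoning
    y<u : toℕ y < toℕ u
    y<u = ≰⇒> (λ u≤y → u∉ (x<u , u≤y))

  pathDist-two-cuts : ∀ {v w s} → InArc x y v →
    pathDist n x v w ≡ s → pathDist n y v w ≡ s → s < g ⊎ s + s ≡ n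
  pathDist-two-cuts {v} {w} v∈ dx dy with inArc? x y w
  ... | yes w∈ = inj₁ (subst (_< g) dx (∣m-n∣<o (pathPos-inArc-< v∈) (pathPos-inArc-< w∈)))
  ... | no  w∉ = inj₂ (equal-complementary-distances {n} {g} {p′ = pathPos n y v} {q′ = pathPos n y w}
    (<-≤-trans (pathPos-inArc-< v∈) (subst (g ≤_) (pathPos-outArc-shift w∉) (m≤n+m g _)))
    (<-≤-trans (pathPos<n x w) (m≤n+m n _))
    (pathPos-inArc-shift v∈) (pathPos-outArc-shift w∉) dx dy)

length-filter+∁ : ∀ {A : Set} {P : A → Set} (P? : U.Decidable P) (xs : List A) →
                  length (filter P? xs) + length (filter (∁? P?) xs) ≡ length xs
length-filter+∁ P? []       = refl
length-filter+∁ P? (x ∷ xs) with P? x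
... | yes _ = cong suc (length-filter+∁ P? xs)
... | no  _ = trans (+-suc _ _) (cong suc (length-filter+∁ P? xs))

length≤2 : ∀ {A : Set} {a b : A} {xs} → Unique xs → All (λ x → x ≡ a ⊎ x ≡ b) xs → length xs ≤ 2
length≤2 {xs = []}                  _ _ = z≤n
length≤2 {xs = _ ∷ []}              _ _ = s≤s z≤n
length≤2 {xs = _ ∷ _ ∷ []}          _ _ = s≤s (s≤s z≤n)
length≤2 {a = a} {b} {x ∷ y ∷ z ∷ _} ((x≢y ∷ x≢z ∷ _) ∷ (y≢z ∷ _) ∷ _) (px ∷ py ∷ pz ∷ _) = ⊥-elim (clash px py pz)
  where
  clash : x ≡ a ⊎ x ≡ b → y ≡ a ⊎ y ≡ b → z ≡ a ⊎ z ≡ b → ⊥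
  clash (inj₁ p) (inj₁ q) _        = x≢y (trans p (sym q))
  clash (inj₂ p) (inj₂ q) _        = x≢y (trans p (sym q))
  clash (inj₁ p) _        (inj₁ r) = x≢z (trans p (sym r))
  clash (inj₂ p) _        (inj₂ r) = x≢z (trans p (sym r))
  clash _        (inj₁ q) (inj₁ r) = y≢z (trans q (sym r))
  clash _        (inj₂ q) (inj₂ r) = y≢z (trans q (sym r))

Unique-resp-↭ : ∀ {A : Set} {xs ys : List A} → xs ↭ ys → Unique xs → Unique ys
Unique-resp-↭ ↭-refl          u                          = u
Unique-resp-↭ (prep x p)     (x∉ ∷ u)                   = All-resp-↭ p x∉ ∷ Unique-resp-↭ p u
Unique-resp-↭ (swap x y p)   ((x≢y ∷ x∉) ∷ (y∉ ∷ u))    =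
  ((≢-sym x≢y) ∷ All-resp-↭ p y∉) ∷ (All-resp-↭ p x∉ ∷ Unique-resp-↭ p u)
Unique-resp-↭ (↭-trans p q)  u                          = Unique-resp-↭ q (Unique-resp-↭ p u)

module _ {A : Set} (Valid : A → Set) (label : A → ℕ)
         (fibre≤2 : ∀ s {xs} → Unique xs → All (λ x → Valid x × label x ≡ s) xs → length xs ≤ 2) where

  length-labelledBelow : ∀ t c {xs} → Unique xs →
    All (λ x → Valid x × (label x < t ⊎ label x ≡ c)) xs → length xs ≤ 2 + 2 * t
  length-labelledBelow zero    c uniq all = fibre≤2 c uniq (All.map onlyC all)
    where
    onlyC : ∀ {x} → Valid x × (label x < 0 ⊎ label x ≡ c) → Valid x × label x ≡ c
    onlyC (vx , inj₂ eq) = vx , eq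
  length-labelledBelow (suc t) c {xs} uniq all = begin
    length xs                                         ≡⟨ length-filter+∁ isT? xs ⟨
    length (filter isT? xs) + length (filter (∁? isT?) xs)
      ≤⟨ +-mono-≤ (fibre≤2 t (Unique.filter⁺ isT? uniq) (All.zip (AllP.filter⁺ isT? (All.map proj₁ all) , AllP.all-filter isT? xs)))
                  (length-labelledBelow t c (Unique.filter⁺ (∁? isT?) uniq)
                     (All.zipWith lower (AllP.filter⁺ (∁? isT?) all , AllP.all-filter (∁? isT?) xs))) ⟩
    2 + (2 + 2 * t)                                   ≡⟨ cong (2 +_) (*-suc 2 t) ⟨
    2 + 2 * suc t                                     ∎
    where
    open ≤-Reasoning
    isT? : U.Decidable (λ x → label x ≡ t)
    isT? x = label x ≟ t
    lower : ∀ {x} → (Valid x × (label x < suc t ⊎ label x ≡ c)) × label x ≢ t →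
            Valid x × (label x < t ⊎ label x ≡ c)
    lower ((vx , inj₁ lt) , ≢t) = vx , inj₁ (≤∧≢⇒< (s≤s⁻¹ lt) ≢t)
    lower ((vx , inj₂ eq) , _)  = vx , inj₂ eq

gaps : List ℕ → List ℕ
gaps (x ∷ y ∷ ks) = y ∸ x ∷ gaps (y ∷ ks)
gaps _            = []

length≤1+length-gaps : ∀ ks → length ks ≤ suc (length (gaps ks))
length≤1+length-gaps []           = z≤n
length≤1+length-gaps (_ ∷ [])     = s≤s z≤n
length≤1+length-gaps (_ ∷ y ∷ ks) = s≤s (length≤1+length-gaps (y ∷ ks))

gaps-< : ∀ {n ks} → All (_< n) ks → All (_< n) (gaps ks)
gaps-< []                   = []
gaps-< (_ ∷ [])             = []
gaps-< {ks = x ∷ y ∷ _} (_ ∷ y<n ∷ ks<n) = ≤-<-trans (m∸n≤m y x) y<n ∷ gaps-< (y<n ∷ ks<n)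

gaps-positive : ∀ {ks} → AllPairs _<_ ks → All (0 <_) (gaps ks)
gaps-positive []                            = []
gaps-positive (_ ∷ [])                      = []
gaps-positive ((x<y ∷ _) ∷ ys@(_ ∷ _)) = m<n⇒0<n∸m x<y ∷ gaps-positive ys

arc : ℕ → ℕ → List ℕ
arc x y = applyUpTo (suc x +_) (y ∸ x)

arc-bounds : ∀ x y → All (λ u → x < u × u ≤ y) (arc x y)
arc-bounds x y = AllP.applyUpTo⁺₁ (suc x +_) (y ∸ x) bounds
  where
  bounds : ∀ {i} → i < y ∸ x → x < suc x + i × suc x + i ≤ y
  bounds {i} i<y∸x = s≤s (m≤m+n x i) , (begin
    suc x + i    ≡⟨ +-suc x i ⟨
    x + suc i    ≤⟨ +-monoʳ-≤ x i<y∸x ⟩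
    x + (y ∸ x)  ≡⟨ m+[n∸m]≡n (<⇒≤ (m∸n≢0⇒n<m {y} {x} (>⇒≢ (≤-<-trans z≤n i<y∸x)))) ⟩
    y            ∎)
    where open ≤-Reasoning

arc-increasing : ∀ x y → AllPairs _<_ (arc x y)
arc-increasing x y = APP.applyUpTo⁺₁ (suc x +_) (y ∸ x) λ i<j _ → +-monoʳ-< (suc x) i<j

arcsBelow : ℕ → List ℕ → List ℕ
arcsBelow s []           = []
arcsBelow s (_ ∷ [])     = []
arcsBelow s (x ∷ y ∷ ks) =
  (if y ∸ x <ᵇ s then arc x y else []) ++ arcsBelow s (y ∷ ks)

sumBelow : ℕ → List ℕ → ℕ
sumBelow s gs = sum (filter (_<? s) gs)

countBelow : ℕ → List ℕ → ℕ
countBelow s gs = length (filter (_<? s) gs)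

length-arcsBelow : ∀ s ks → length (arcsBelow s ks) ≡ sumBelow s (gaps ks)
length-arcsBelow s []           = refl
length-arcsBelow s (_ ∷ [])     = refl
length-arcsBelow s (x ∷ y ∷ ks) with y ∸ x <ᵇ s | length-arcsBelow s (y ∷ ks)
... | true  | rest = begin
  length (arc x y ++ arcsBelow s (y ∷ ks))           ≡⟨ length-++ (arc x y) ⟩
  length (arc x y) + length (arcsBelow s (y ∷ ks))   ≡⟨ cong₂ _+_ (length-applyUpTo (suc x +_) (y ∸ x)) rest ⟩
  y ∸ x + sumBelow s (gaps (y ∷ ks))                 ∎
  where open ≡-Reasoning
... | false | rest = rest

arcsBelow-all : ∀ {P Q : ℕ → Set} s {ks} → All Q ks →
  (∀ {x y u} → Q x → Q y → y ∸ x < s → x < u → u ≤ y → P u) → All P (arcsBelow s ks)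
arcsBelow-all s []                  _ = []
arcsBelow-all s (_ ∷ [])            _ = []
arcsBelow-all {P} s {x ∷ y ∷ ks} (qx ∷ qy ∷ qks) arcP
  with y ∸ x <ᵇ s | <ᵇ-reflects-< (y ∸ x) s | arcsBelow-all s (qy ∷ qks) arcP
... | true  | ofʸ short | rest = AllP.++⁺ (All.map (λ (x<u , u≤y) → arcP qx qy short x<u u≤y) (arc-bounds x y)) rest
... | false | _         | rest = rest

arcsBelow-increasing : ∀ s {ks} → AllPairs _<_ ks → AllPairs _<_ (arcsBelow s ks)
arcsBelow-increasing s []       = []
arcsBelow-increasing s (_ ∷ []) = []
arcsBelow-increasing s {x ∷ y ∷ ks} ((x<y ∷ x<ks) ∷ y∷ks↗) with y ∸ x <ᵇ s
... | true  = APP.++⁺ (arc-increasing x y) (arcsBelow-increasing s y∷ks↗)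
                (All.map (λ (_ , u≤y) → All.map (≤-<-trans u≤y) beyond-y) (arc-bounds x y))
  where
  beyond-y : All (y <_) (arcsBelow s (y ∷ ks))
  beyond-y = arcsBelow-all s (≤-refl ∷ All.map <⇒≤ (AllPairs.head y∷ks↗))
               (λ y≤x′ _ _ x′<u _ → ≤-<-trans y≤x′ x′<u)
... | false = arcsBelow-increasing s y∷ks↗

-- A gap below s₂ is either below s or contributes at least s to the sum.
countBelow-weighted : ∀ {s s₂} gs → countBelow s₂ gs * s ≤ countBelow s gs * s + sumBelow s₂ gs
countBelow-weighted [] = z≤n
countBelow-weighted {s} {s₂} (g ∷ gs)
  with g <ᵇ s₂ | g <ᵇ s | <ᵇ-reflects-< g s | countBelow-weighted {s} {s₂} gs
... | true  | true  | _        | ih = begin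
  s + c₂ * s              ≤⟨ +-monoʳ-≤ s ih ⟩
  s + (c * s + S)         ≡⟨ +-assoc s (c * s) S ⟨
  s + c * s + S           ≤⟨ +-monoʳ-≤ (s + c * s) (m≤n+m S g) ⟩
  s + c * s + (g + S)     ∎
  where
  open ≤-Reasoning
  c₂ = countBelow s₂ gs
  c  = countBelow s gs
  S  = sumBelow s₂ gs
... | true  | false | ofⁿ g≮s | ih = begin
  s + c₂ * s              ≤⟨ +-mono-≤ (≮⇒≥ g≮s) ih ⟩
  g + (c * s + S)         ≡⟨ +-assoc g (c * s) S ⟨
  g + c * s + S           ≡⟨ cong (_+ S) (+-comm g (c * s)) ⟩
  c * s + g + S           ≡⟨ +-assoc (c * s) g S ⟩
  c * s + (g + S)         ∎
  where
  open ≤-Reasoning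
  c₂ = countBelow s₂ gs
  c  = countBelow s gs
  S  = sumBelow s₂ gs
... | false | true  | _        | ih = begin
  c₂ * s                  ≤⟨ ih ⟩
  c * s + S               ≤⟨ m≤n+m (c * s + S) s ⟩
  s + (c * s + S)         ≡⟨ +-assoc s (c * s) S ⟨
  s + c * s + S           ∎
  where
  open ≤-Reasoning
  c₂ = countBelow s₂ gs
  c  = countBelow s gs
  S  = sumBelow s₂ gs
... | false | false | _        | ih = ih

countBelow-doubling : ∀ {s} .{{_ : NonZero s}} gs → sumBelow (2 * s) gs ≤ 2 + 2 * (2 * s) →
                      countBelow (2 * s) gs ≤ 6 + countBelow s gs
countBelow-doubling {s} gs sum≤ = *-cancelʳ-≤ (countBelow (2 * s) gs) (6 + countBelow s gs) s (begin
  countBelow (2 * s) gs * s           ≤⟨ countBelow-weighted gs ⟩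
  countBelow s gs * s + sumBelow (2 * s) gs
                                      ≤⟨ +-monoʳ-≤ (countBelow s gs * s) sum≤ ⟩
  countBelow s gs * s + (2 + 2 * (2 * s))
                                      ≤⟨ +-monoʳ-≤ (countBelow s gs * s) (+-monoˡ-≤ (2 * (2 * s)) (*-monoʳ-≤ 2 (>-nonZero⁻¹ s))) ⟩
  countBelow s gs * s + (2 * s + 2 * (2 * s))
                                      ≡⟨ regroup (countBelow s gs) s ⟩
  (6 + countBelow s gs) * s           ∎)
  where
  open ≤-Reasoning
  regroup : ∀ c s → c * s + (2 * s + 2 * (2 * s)) ≡ (6 + c) * s
  regroup = solve-∀

n<2^[1+⌊log₂n⌋] : ∀ n → n < 2 ^ suc ⌊log₂ n ⌋
n<2^[1+⌊log₂n⌋] n = ≰⇒> λ 2^[1+log]≤n →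
  1+n≰n (subst (_≤ ⌊log₂ n ⌋) (⌊log₂[2^n]⌋≡n (suc ⌊log₂ n ⌋)) (⌊log₂⌋-mono-≤ 2^[1+log]≤n))

countBelow-2^ : ∀ {gs} → All (0 <_) gs → (∀ s → sumBelow s gs ≤ 2 + 2 * s) →
                ∀ j → countBelow (2 ^ j) gs ≤ 6 * j
countBelow-2^ pos sum≤ zero =
  ≤-reflexive (cong length (filter-none (_<? 1) (All.map (λ 0<g → ≤⇒≯ 0<g) pos)))
countBelow-2^ {gs} pos sum≤ (suc j) = begin
  countBelow (2 * 2 ^ j) gs   ≤⟨ countBelow-doubling {{m^n≢0 2 j}} gs (sum≤ (2 * 2 ^ j)) ⟩
  6 + countBelow (2 ^ j) gs   ≤⟨ +-monoʳ-≤ 6 (countBelow-2^ pos sum≤ j) ⟩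
  6 + 6 * j                   ≡⟨ *-suc 6 j ⟨
  6 * suc j                   ∎
  where open ≤-Reasoning

module _ {m : ℕ} {f : Labelling m} (sk : IsSkolemCircle m f) where
  open IsSkolemCircle sk

  partner : ∀ v → Σ (Fin (2 * m)) λ w → v ≢ w × f v ≡ f w
  partner v with usedTwice (f v) (proj₁ (labelRange v)) (proj₂ (labelRange v))
  ... | a , b , a≢b , fa , fb , onlyAB with onlyAB v refl
  ... | inj₁ refl = b , a≢b , sym fb
  ... | inj₂ refl = a , ≢-sym a≢b , sym fa

  label-inArc : ∀ {x y v g} → toℕ y ≡ toℕ x + g → Removable m f x → Removable m f y →
                InArc x y v → f v < g ⊎ f v ≡ m
  label-inArc {x} {y} {v} y≡x+g rx ry v∈ with partner v
  ... | w , v≢w , fv≡fw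
    with pathDist-two-cuts x y y≡x+g {w = w} v∈ (rx v w v≢w fv≡fw) (ry v w v≢w fv≡fw)
  ... | inj₁ fv<g      = inj₁ fv<g
  ... | inj₂ fv+fv≡2m = inj₂ (*-cancelˡ-≡ (f v) m 2 (trans (cong (f v +_) (+-identityʳ (f v))) fv+fv≡2m))

  -- Junk value 0 beyond the cycle.
  labelAt : ℕ → ℕ
  labelAt u with u <? 2 * m
  ... | yes u<2m = f (fromℕ< u<2m)
  ... | no  _    = 0

  labelAt-fromℕ< : ∀ {u} (u<2m : u < 2 * m) → labelAt u ≡ f (fromℕ< u<2m)
  labelAt-fromℕ< {u} u<2m with u <? 2 * m
  ... | yes _    = refl
  ... | no  u≮2m = contradiction u<2m u≮2m

  labelAt-fibre≤2 : ∀ s {us} → Unique us → All (λ u → u < 2 * m × labelAt u ≡ s) us → length us ≤ 2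
  labelAt-fibre≤2 s {[]}    _    _                         = z≤n
  labelAt-fibre≤2 s {u ∷ _} uniq all@((u<2m , labelAt≡s) ∷ _)
    with fu≡s ← trans (sym (labelAt-fromℕ< u<2m)) labelAt≡s
    with usedTwice s (subst (1 ≤_) fu≡s (proj₁ (labelRange (fromℕ< u<2m))))
                     (subst (_≤ m) fu≡s (proj₂ (labelRange (fromℕ< u<2m))))
  ... | a , b , _ , _ , _ , onlyAB = length≤2 uniq (All.map atAB all)
    where
    atAB : ∀ {v} → v < 2 * m × labelAt v ≡ s → v ≡ toℕ a ⊎ v ≡ toℕ b
    atAB {v} (v<2m , labelAt≡s) with onlyAB (fromℕ< v<2m) (trans (sym (labelAt-fromℕ< v<2m)) labelAt≡s)
    ... | inj₁ refl = inj₁ (sym (toℕ-fromℕ< v<2m))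
    ... | inj₂ refl = inj₂ (sym (toℕ-fromℕ< v<2m))

  RemovableAt : ℕ → Set
  RemovableAt k = Σ (Fin (2 * m)) λ e → toℕ e ≡ k × Removable m f e

  sumBelow-removable : ∀ s {ks} → AllPairs _<_ ks → All RemovableAt ks → sumBelow s (gaps ks) ≤ 2 + 2 * s
  sumBelow-removable s {ks} ks↗ removable = begin
    sumBelow s (gaps ks)      ≡⟨ length-arcsBelow s ks ⟨
    length (arcsBelow s ks)   ≤⟨ length-labelledBelow (_< 2 * m) labelAt labelAt-fibre≤2 s m
                                   (AllPairs.map <⇒≢ (arcsBelow-increasing s ks↗))
                                   (arcsBelow-all s removable labelled) ⟩
    2 + 2 * s                 ∎
    where
    open ≤-Reasoning
    labelled : ∀ {x y u} → RemovableAt x → RemovableAt y → y ∸ x < s → x < u → u ≤ y →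
               u < 2 * m × (labelAt u < s ⊎ labelAt u ≡ m)
    labelled {u = u} (ex , refl , rx) (ey , refl , ry) short x<u u≤y =
      u<2m , subst (λ l → l < s ⊎ l ≡ m) (sym (labelAt-fromℕ< u<2m))
                   (Sum.map₁ (λ below-gap → <-trans below-gap short) (label-inArc y≡x+gap rx ry u∈))
      where
      u<2m : u < 2 * m
      u<2m = ≤-<-trans u≤y (toℕ<n ey)
      y≡x+gap : toℕ ey ≡ toℕ ex + (toℕ ey ∸ toℕ ex)
      y≡x+gap = sym (m+[n∸m]≡n (<⇒≤ (<-≤-trans x<u u≤y)))
      u∈ : InArc ex ey (fromℕ< u<2m)
      u∈ = subst (λ z → toℕ ex < z × z ≤ toℕ ey) (sym (toℕ-fromℕ< u<2m)) (x<u , u≤y)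

  removableEdges-bound : ∀ {es} → Unique es → All (Removable m f) es → length es ≤ 13 + 6 * ⌊log₂ m ⌋
  removableEdges-bound {es} uniq removable = begin
    length es                           ≡⟨ length-map toℕ es ⟨
    length (map toℕ es)                 ≡⟨ ↭-length (sort-↭ (map toℕ es)) ⟨
    length ks                           ≤⟨ length≤1+length-gaps ks ⟩
    suc (length (gaps ks))              ≡⟨ cong (suc ∘ length) (filter-all (_<? 2 ^ j) gaps<2^j) ⟨
    suc (countBelow (2 ^ j) (gaps ks))  ≤⟨ s≤s (countBelow-2^ (gaps-positive ks↗) (λ s → sumBelow-removable s ks↗ ks-removable) j) ⟩
    suc (6 * j)                         ≡⟨ cong suc (*-distribˡ-+ 6 2 ⌊log₂ m ⌋) ⟩
    13 + 6 * ⌊log₂ m ⌋                  ∎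
    where
    open ≤-Reasoning
    ks : List ℕ
    ks = sort (map toℕ es)
    j : ℕ
    j = 2 + ⌊log₂ m ⌋
    ks↗ : AllPairs _<_ ks
    ks↗ = AllPairs.zipWith (uncurry ≤∧≢⇒<)
            ( Linked⇒AllPairs ≤-trans (sort-↗ (map toℕ es))
            , Unique-resp-↭ (↭-sym (sort-↭ (map toℕ es))) (Unique.map⁺ toℕ-injective uniq))
    ks-removable : All RemovableAt ks
    ks-removable = All-resp-↭ (↭-sym (sort-↭ (map toℕ es))) (AllP.map⁺ (All.map (λ {e} r → e , refl , r) removable))
    gaps<2^j : All (_< 2 ^ j) (gaps ks)
    gaps<2^j = All.map (λ g<2m → <-trans g<2m (*-monoʳ-< 2 (n<2^[1+⌊log₂n⌋] m)))
                       (gaps-< (All.map (λ (e , e≡k , _) → subst (_< 2 * m) e≡k (toℕ<n e)) ks-removable))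

theorem9 : Σ ℕ λ K → ∀ (m : ℕ) → 2 ≤ m → (f : Labelling m) → IsSkolemCircle m f →
             (es : List (Fin (2 * m))) → Unique es → All (Removable m f) es →
             length es ≤ K * ⌊log₂ m ⌋
theorem9 = 19 , λ m 2≤m f sk es uniq removable → begin
  length es                           ≤⟨ removableEdges-bound sk uniq removable ⟩
  13 + 6 * ⌊log₂ m ⌋                  ≤⟨ +-monoˡ-≤ (6 * ⌊log₂ m ⌋) (*-monoʳ-≤ 13 (⌊log₂⌋-mono-≤ 2≤m)) ⟩
  13 * ⌊log₂ m ⌋ + 6 * ⌊log₂ m ⌋      ≡⟨ *-distribʳ-+ ⌊log₂ m ⌋ 13 6 ⟨
  19 * ⌊log₂ m ⌋                      ∎
  where open ≤-Reasoning
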